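{- Let $P=([n],\preceq)$ be a poset, $w$ a weight on $\mathbb{F}_q$, and let $k_i=k$ for all $i\in[n]$, $N=nk$. Let $\mathbb{C}\subseteq\mathbb{F}_q^N$ be a code with $|\mathbb{C}|\ge2$ and minimum distance $d_{(P,w,\pi)}(\mathbb{C})$. If $\mathbb{C}$ is MDS, then $$M_w\Big(n-\frac{\lceil\log_q|\mathbb{C}|\rceil}{k}\Big)+1\le d_{(P,w,\pi)}(\mathbb{C})\le M_w\Big(n-\frac{\lceil\log_q|\mathbb{C}|\rceil}{k}+1\Big).$$
   Context: A weight on $\mathbb{F}_q$ is a map $w:\mathbb{F}_q\to\mathbb{N}\cup\{0\}$ with $w(\alpha)=0$ iff $\alpha=0$, $w(-\alpha)=w(\alpha)$, $w(\alpha+\beta)\le w(\alpha)+w(\beta)$; $M_w=\max_\alpha w(\alpha)$; $\tilde w^k(v)=\max_s w(v_s)$. Ideals of $P$ are down-closed subsets; $\langle A\rangle$ is the generated ideal; $\mathcal{I}^r$ is the set of ideals of cardinality $r$. For $x=x_1\oplus\cdots\oplus x_n\in(\mathbb{F}_q^k)^{\oplus n}$, $supp_\pi(x)=\{i:x_i\ne0\}$, $I_x=\langle supp_\pi(x)\rangle$, $M_x$ its maximal elements, $w_{(P,w,\pi)}(x)=\sum_{i\in M_x}\tilde w^{k}(x_i)+|I_x\setminus M_x|\,M_w$, $d_{(P,w,\pi)}(x,y)=w_{(P,w,\pi)}(x-y)$, and $d_{(P,w,\pi)}(\mathbb{C})$ is the minimum distance between distinct codewords. $\mathbb{C}$ is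 MDS if $\max_{J\in\mathcal{I}^r}\{\sum_{i\in J}k_i\}=N-\lceil\log_q|\mathbb{C}|\rceil$ where $r=\lfloor(d_{(P,w,\pi)}(\mathbb{C})-1)/M_w\rfloor$. -}

module Defs where

open import Level using (0ℓ)
open import Data.Nat using (ℕ; zero; suc; _+_; _*_; _∸_; _^_; _≤_; _<_; _⊔_)
open import Data.Bool using (Bool; true; false; _∧_; _∨_; not)
open import Data.Fin using (Fin)
open import Data.Fin.Subset using (Subset; _∈_; ∣_∣)
open import Data.Vec using (Vec; lookup; tabulate; foldr; map; zipWith)
import Data.Vec as V
open import Data.List using (List)
open import Data.List.Membership.Propositional renaming (_∈_ to _∈ₗ_)
open import Data.Product using (Σ; ∃; _×_; _,_)
open import Relation.Nullary using (¬_; Dec; yes; no)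
open import Relation.Nullary.Decidable using (⌊_⌋)
open import Relation.Binary.PropositionalEquality using (_≡_; _≢_)
open import Relation.Binary.Structures using (IsPartialOrder)
open import Relation.Binary.Definitions using (DecidableEquality; Decidable)
open import Algebra.Structures using (IsCommutativeRing)
open import Function.Bundles using (_↔_; Inverse)

record FiniteField (q : ℕ) : Set₁ where
  field
    F      : Set
    _+F_ _*F_ : F → F → F
    -F_    : F → F
    0F 1F  : F
    isCommutativeRing : IsCommutativeRing _≡_ _+F_ _*F_ -F_ 0F 1F
    1≢0    : 1F ≢ 0F
    inv    : ∀ (a : F) → a ≢ 0F → Σ F λ b → a *F b ≡ 1F
    _≟F_   : DecidableEquality F
    enum   : Fin q ↔ F

  _-F_ : F → F → F
  a -F b = a +F (-F b)

module _ {q : ℕ} (𝔽 : FiniteField q) where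
  open FiniteField 𝔽

  record IsWeight (w : F → ℕ) : Set where
    field
      zero-iff : ∀ α → (w α ≡ 0 → α ≡ 0F) × (α ≡ 0F → w α ≡ 0)
      symm     : ∀ α → w (-F α) ≡ w α
      triangle : ∀ α β → w (α +F β) ≤ w α + w β

  Mw : (F → ℕ) → ℕ
  Mw w = foldr _ _⊔_ 0 (tabulate {n = q} (λ i → w (Inverse.to enum i)))

  wt~ : (F → ℕ) → ∀ {k} → Vec F k → ℕ
  wt~ w v = foldr _ _⊔_ 0 (map w v)

record Poset (n : ℕ) : Set₁ where
  field
    _≼_  : Fin n → Fin n → Set
    isPartialOrder : IsPartialOrder _≡_ _≼_
    _≼?_ : Decidable _≼_

module _ {n : ℕ} (P : Poset n) where
  open Poset P

  IsIdeal : Subset n → Set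
  IsIdeal J = ∀ i j → j ≼ i → i ∈ J → j ∈ J

  anyFin : ∀ {m} → (Fin m → Bool) → Bool
  anyFin f = foldr _ _∨_ false (tabulate f)

  generated : Subset n → Subset n
  generated A = tabulate λ j → anyFin λ i → lookup A i ∧ ⌊ j ≼? i ⌋

  maximals : Subset n → Subset n
  maximals I = tabulate λ i → lookup I i ∧
    not (anyFin λ j → lookup I j ∧ (⌊ i ≼? j ⌋ ∧ not ⌊ Data.Fin._≟_ i j ⌋))

  diff : Subset n → Subset n → Subset n
  diff A B = zipWith (λ a b → a ∧ not b) A B

module _ {q : ℕ} (𝔽 : FiniteField q) {n : ℕ} (P : Poset n)
         (w : FiniteField.F 𝔽 → ℕ) (k : ℕ) where
  open FiniteField 𝔽

  Word : Set
  Word = Vec (Vec F k) n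

  isZeroVec : ∀ {m} → Vec F m → Bool
  isZeroVec v = foldr _ _∧_ true (map (λ a → ⌊ a ≟F 0F ⌋) v)

  supp : Word → Subset n
  supp x = map (λ xi → not (isZeroVec xi)) x

  Ix : Word → Subset n
  Ix x = generated P (supp x)

  Mx : Word → Subset n
  Mx x = maximals P (Ix x)

  sumFin : ∀ {m} → (Fin m → ℕ) → ℕ
  sumFin f = foldr _ _+_ 0 (tabulate f)

  weightPwπ : Word → ℕ
  weightPwπ x =
    sumFin (λ i → if-in (lookup (Mx x) i) (wt~ 𝔽 w (lookup x i)))
    + ∣ diff P (Ix x) (Mx x) ∣ * Mw 𝔽 w
    where
      if-in : Bool → ℕ → ℕ
      if-in true  m = m
      if-in false _ = 0

  distPwπ : Word → Word → ℕ
  distPwπ x y = weightPwπ (zipWith (zipWith _-F_) x y)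

  IsMinDist : List Word → ℕ → Set
  IsMinDist C d =
    (∃ λ x → ∃ λ y → x ∈ₗ C × y ∈ₗ C × x ≢ y × distPwπ x y ≡ d)
    × (∀ x y → x ∈ₗ C → y ∈ₗ C → x ≢ y → d ≤ distPwπ x y)

  sumK : Subset n → ℕ
  sumK J = sumFin (λ i → if-in (lookup J i))
    where
      if-in : Bool → ℕ
      if-in true  = k
      if-in false = 0

  IsMaxOverIdeals : ℕ → ℕ → Set
  IsMaxOverIdeals r m =
    (∃ λ J → IsIdeal P J × ∣ J ∣ ≡ r × sumK J ≡ m)
    × (∀ J → IsIdeal P J → ∣ J ∣ ≡ r → sumK J ≤ m)

IsCeilLog : ℕ → ℕ → ℕ → Set
IsCeilLog q m L = m ≤ q ^ L × (∀ L′ → m ≤ q ^ L′ → L ≤ L′)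

IsFloorDiv : ℕ → ℕ → ℕ → Set
IsFloorDiv a b r = r * b ≤ a × a < suc r * b

module _ {q : ℕ} (𝔽 : FiniteField q) {n : ℕ} (P : Poset n)
         (w : FiniteField.F 𝔽 → ℕ) (k : ℕ) where

  IsMDS : List (Word 𝔽 P w k) → Set
  IsMDS C = ∀ d L r → IsMinDist 𝔽 P w k C d
    → IsCeilLog q (Data.List.length C) L
    → IsFloorDiv (d ∸ 1) (Mw 𝔽 w) r
    → IsMaxOverIdeals 𝔽 P w k r (n * k ∸ L)

-- With constant block size k, every ideal J has Σ_{i∈J} k_i = |J| k, so the MDS
-- condition says that r = ⌊(d - 1)/M_w⌋ satisfies r k = n k - ⌈log_q |C|⌉.
-- Both bounds are then r M_w < d ≤ (r + 1) M_w multiplied by k.  What remains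
-- is to see that the quantities involved are meaningful: M_w ≥ 1, d ≥ 1 (a
-- nonzero coordinate of x - y is charged at least its weight, either as part
-- of a maximal block or through the term M_w), and ⌈log_q |C|⌉ ≤ n k because
-- the q^{nk} words can hold at most that many distinct codewords.
module Submission where

open import Defs
open import Data.Nat using (ℕ)
open import Data.Integer using (+_; _+_; _-_; _*_; _≤_; _⊖_; +≤+)
open import Data.List using (List; length)
open import Data.List.Relation.Unary.Unique.Propositional using (Unique)
open import Data.Product using (_×_)

open import Algebra.Bundles using (Group)
open import Algebra.Structures using (IsCommutativeRing)
import Algebra.Properties.Group as GroupProperties
open import Data.Bool using (Bool; true; false; _∧_; _∨_; not; if_then_else_)
open import Data.Bool.Properties using (∨-zeroʳ; ∧-zeroʳ)
open import Data.Empty using (⊥-elim)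
open import Data.Fin using (Fin; zero; suc)
open import Data.Fin.Properties using (injective⇒≤; ¬∀⟶∃¬)
open import Data.Fin.Subset using (Subset; _∈_; ⁅_⁆; ∣_∣)
open import Data.Fin.Subset.Properties using (p⊆q⇒∣p∣≤∣q∣; x∈⁅y⁆⇒x≡y; ∣⁅x⁆∣≡1)
import Data.Integer.Properties as ℤ
import Data.List as List
open import Data.List.Membership.Propositional.Properties using (∈-lookup)
open import Data.List.Relation.Unary.AllPairs using (_∷_)
import Data.List.Relation.Unary.All as All
import Data.Nat as ℕ
open import Data.Nat using (suc; NonZero; _⊔_; _^_)
open import Data.Nat.DivMod using (_/_; _%_; m≡m%n+[m/n]*n; m%n<n)
import Data.Nat.Properties as ℕₚ
open import Data.Nat.Solver using (module +-*-Solver)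
open import Data.Product using (Σ; ∃; _,_; proj₁; proj₂)
open import Data.Vec using (Vec; []; _∷_; foldr; lookup; tabulate; map; zipWith; sum)
open import Data.Vec.Properties
  using (lookup∘tabulate; lookup-map; lookup-zipWith; tabulate∘lookup; tabulate-cong; lookup⇒[]=; ≡-dec)
open import Data.Vec.Recursive using (lift↔; Fin[m^n]↔Fin[m]^n)
open import Data.Vec.Recursive.Properties using (↔Vec)
open import Function using (_∘_)
open import Function.Bundles using (_↔_; _↣_; Inverse; Injection)
open import Function.Definitions using (Injective)
open import Function.Properties.Inverse using (↔-trans; ↔-sym; ↔⇒↣)
open import Relation.Binary.Definitions using (DecidableEquality)
open import Relation.Binary.PropositionalEquality
  using (_≡_; _≢_; refl; sym; trans; cong; cong₂; subst; subst₂; module ≡-Reasoning)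
open import Relation.Binary.Structures using (IsPartialOrder)
open import Relation.Nullary using (yes; no)
open import Relation.Nullary.Decidable using (⌊_⌋; isYes≗does; dec-true; dec-false)

private
  variable
    A : Set
    m : ℕ

lookup≤foldr : {_⊕_ : ℕ → ℕ → ℕ} → (∀ a b → a ℕ.≤ a ⊕ b) → (∀ a b → b ℕ.≤ a ⊕ b) →
               ∀ e (v : Vec ℕ m) i → lookup v i ℕ.≤ foldr _ _⊕_ e v
lookup≤foldr ≤ˡ ≤ʳ e (a ∷ v) zero    = ≤ˡ a _
lookup≤foldr ≤ˡ ≤ʳ e (a ∷ v) (suc i) = ℕₚ.≤-trans (lookup≤foldr ≤ˡ ≤ʳ e v i) (≤ʳ a _)

lookup≤sum : ∀ (v : Vec ℕ m) i → lookup v i ℕ.≤ sum v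
lookup≤sum = lookup≤foldr ℕₚ.m≤m+n (λ a b → ℕₚ.m≤n+m b a) 0

lookup≤max : ∀ (v : Vec ℕ m) i → lookup v i ℕ.≤ foldr _ _⊔_ 0 v
lookup≤max = lookup≤foldr ℕₚ.m≤m⊔n ℕₚ.m≤n⊔m 0

lookup-true⇒or : ∀ (v : Vec Bool m) i → lookup v i ≡ true → foldr _ _∨_ false v ≡ true
lookup-true⇒or (b ∷ v) zero    refl = refl
lookup-true⇒or (b ∷ v) (suc i) e    = trans (cong (b ∨_) (lookup-true⇒or v i e)) (∨-zeroʳ b)

lookup-false⇒and : ∀ (v : Vec Bool m) i → lookup v i ≡ false → foldr _ _∧_ true v ≡ false
lookup-false⇒and (b ∷ v) zero    refl = ∧-zeroʳ false
lookup-false⇒and (b ∷ v) (suc i) e    = trans (cong (b ∧_) (lookup-false⇒and v i e)) (∧-zeroʳ b)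

≢⇒∃lookup≢ : DecidableEquality A → {u v : Vec A m} → u ≢ v → ∃ λ i → lookup u i ≢ lookup v i
≢⇒∃lookup≢ _≟_ {u} {v} u≢v = ¬∀⟶∃¬ _ _ (λ i → lookup u i ≟ lookup v i) (u≢v ∘ lookup-ext)
  where
  lookup-ext : (∀ i → lookup u i ≡ lookup v i) → u ≡ v
  lookup-ext eq = trans (sym (tabulate∘lookup u)) (trans (tabulate-cong eq) (tabulate∘lookup v))

sum-indicator : ∀ k (J : Subset m) (f : Fin m → ℕ) →
                (∀ i → f i ≡ (if lookup J i then k else 0)) → sum (tabulate f) ≡ ∣ J ∣ ℕ.* k
sum-indicator k []          f f≗ = refl
sum-indicator k (true ∷ J)  f f≗ = cong₂ ℕ._+_ (f≗ zero) (sum-indicator k J (f ∘ suc) (f≗ ∘ suc))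
sum-indicator k (false ∷ J) f f≗ = cong₂ ℕ._+_ (f≗ zero) (sum-indicator k J (f ∘ suc) (f≗ ∘ suc))

lookup-true⇒1≤∣∣ : ∀ (p : Subset m) i → lookup p i ≡ true → 1 ℕ.≤ ∣ p ∣
lookup-true⇒1≤∣∣ p i e = subst (ℕ._≤ ∣ p ∣) (∣⁅x⁆∣≡1 i) (p⊆q⇒∣p∣≤∣q∣ ⁅i⁆⊆p)
  where
  ⁅i⁆⊆p : ∀ {j} → j ∈ ⁅ i ⁆ → j ∈ p
  ⁅i⁆⊆p j∈⁅i⁆ rewrite x∈⁅y⁆⇒x≡y i j∈⁅i⁆ = lookup⇒[]= i p e

lookup-injective : {xs : List A} → Unique xs → Injective _≡_ _≡_ (List.lookup xs)
lookup-injective {xs = _ List.∷ _} _            {zero}  {zero}  _ = refl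
lookup-injective {xs = _ List.∷ _} (x∉xs ∷ _)   {zero}  {suc j} e = ⊥-elim (All.lookup x∉xs (∈-lookup j) e)
lookup-injective {xs = _ List.∷ _} (x∉xs ∷ _)   {suc i} {zero}  e = ⊥-elim (All.lookup x∉xs (∈-lookup i) (sym e))
lookup-injective {xs = _ List.∷ _} (_ ∷ unique) {suc i} {suc j} e = cong suc (lookup-injective unique e)

Unique⇒length≤ : ∀ {c} {xs : List A} → A ↣ Fin c → Unique xs → length xs ℕ.≤ c
Unique⇒length≤ {xs = xs} f unique =
  injective⇒≤ {f = Injection.to f ∘ List.lookup xs} (lookup-injective unique ∘ Injection.injective f)

Fin^↔Vec : ∀ {s} → Fin s ↔ A → ∀ m → Fin (s ^ m) ↔ Vec A m
Fin^↔Vec e m = ↔-trans (Fin[m^n]↔Fin[m]^n _ m) (↔-trans (lift↔ m e) (↔Vec m))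

isFloorDiv-/ : ∀ a M .{{_ : NonZero M}} → IsFloorDiv a M (a / M)
isFloorDiv-/ a M = subst (a / M ℕ.* M ℕ.≤_) (sym a≡) (ℕₚ.m≤n+m _ _)
                 , subst (ℕ._< suc (a / M) ℕ.* M) (sym a≡) (ℕₚ.+-monoˡ-< (a / M ℕ.* M) (m%n<n a M))
  where
  a≡ : a ≡ a % M ℕ.+ a / M ℕ.* M
  a≡ = m≡m%n+[m/n]*n a M

isFloorDiv-pred⇒bounds : ∀ {d M r} → 1 ℕ.≤ d → IsFloorDiv (d ℕ.∸ 1) M r →
                         suc (r ℕ.* M) ℕ.≤ d × d ℕ.≤ suc r ℕ.* M
isFloorDiv-pred⇒bounds {d} 1≤d (lower , upper) rewrite sym (ℕₚ.m+[n∸m]≡n 1≤d) = ℕ.s≤s lower , upper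

module _ {q : ℕ} (𝔽 : FiniteField q) where
  open FiniteField 𝔽

  private
    +-group : Group _ _
    +-group = record { isGroup = IsCommutativeRing.+-isGroup isCommutativeRing }

  -F≡0⇒≡ : ∀ a b → a -F b ≡ 0F → a ≡ b
  -F≡0⇒≡ = GroupProperties.x∙y⁻¹≈ε⇒x≈y +-group

  w≤Mw : ∀ (w : F → ℕ) α → w α ℕ.≤ Mw 𝔽 w
  w≤Mw w α = subst (λ β → w β ℕ.≤ Mw 𝔽 w) (Inverse.strictlyInverseˡ enum α)
    (subst (ℕ._≤ Mw 𝔽 w) (lookup∘tabulate _ i) (lookup≤max (tabulate (w ∘ Inverse.to enum)) i))
    where i = Inverse.from enum α

  w-lookup≤wt~ : ∀ (w : F → ℕ) (v : Vec F m) s → w (lookup v s) ℕ.≤ wt~ 𝔽 w v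
  w-lookup≤wt~ w v s = subst (ℕ._≤ wt~ 𝔽 w v) (lookup-map s w v) (lookup≤max (map w v) s)

  Word↔Fin : ∀ {n} k → Vec (Vec F k) n ↔ Fin (q ^ (n ℕ.* k))
  Word↔Fin {n} k = subst (λ c → Vec (Vec F k) n ↔ Fin c) [q^k]^n≡q^[n*k] (↔-sym (Fin^↔Vec (Fin^↔Vec enum k) n))
    where [q^k]^n≡q^[n*k] = trans (ℕₚ.^-*-assoc q k n) (cong (q ^_) (ℕₚ.*-comm k n))

  module _ {w : F → ℕ} (isWeight : IsWeight 𝔽 w) where
    open IsWeight isWeight

    ≢0⇒1≤w : ∀ {α} → α ≢ 0F → 1 ℕ.≤ w α
    ≢0⇒1≤w α≢0 = ℕₚ.n≢0⇒n>0 (α≢0 ∘ proj₁ (zero-iff _))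

    1≤Mw : 1 ℕ.≤ Mw 𝔽 w
    1≤Mw = ℕₚ.≤-trans (≢0⇒1≤w 1≢0) (w≤Mw w 1F)

module _ {n : ℕ} (P : Poset n) where
  open Poset P

  generated-⊇ : ∀ A i → lookup A i ≡ true → lookup (generated P A) i ≡ true
  generated-⊇ A i i∈A = trans (lookup∘tabulate _ i) (lookup-true⇒or below-i i i-below-i)
    where
    below-i = tabulate λ j → lookup A j ∧ ⌊ i ≼? j ⌋
    i-below-i : lookup below-i i ≡ true
    i-below-i = trans (lookup∘tabulate _ i)
      (cong₂ _∧_ i∈A (trans (isYes≗does (i ≼? i)) (dec-true (i ≼? i) (IsPartialOrder.refl isPartialOrder))))

  lookup-diff : ∀ I J i → lookup I i ≡ true → lookup J i ≡ false → lookup (diff P I J) i ≡ true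
  lookup-diff I J i i∈I i∉J = trans (lookup-zipWith _ i I J) (cong₂ (λ a b → a ∧ not b) i∈I i∉J)

module _ {q : ℕ} (𝔽 : FiniteField q) {n : ℕ} (P : Poset n) (w : FiniteField.F 𝔽 → ℕ) (k : ℕ) where
  open FiniteField 𝔽

  private
    W = Word 𝔽 P w k

  -- `weightPwπ` and `sumK` sum locally defined case splits, which can only be
  -- named by exposing them as existential witnesses.
  weight-split : ∀ (z : W) → Σ (Fin n → ℕ) λ f →
    weightPwπ 𝔽 P w k z ≡ sum (tabulate f) ℕ.+ ∣ diff P (Ix 𝔽 P w k z) (Mx 𝔽 P w k z) ∣ ℕ.* Mw 𝔽 w
  weight-split z = _ , refl

  weight-summand-maximal : ∀ z i → lookup (Mx 𝔽 P w k z) i ≡ true →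
                           proj₁ (weight-split z) i ≡ wt~ 𝔽 w (lookup z i)
  weight-summand-maximal z i i∈Mx with lookup (Mx 𝔽 P w k z) i
  weight-summand-maximal z i refl | true = refl

  wt~≤weight : ∀ z i → lookup (Mx 𝔽 P w k z) i ≡ true → wt~ 𝔽 w (lookup z i) ℕ.≤ weightPwπ 𝔽 P w k z
  wt~≤weight z i i∈Mx = begin
    wt~ 𝔽 w (lookup z i)                    ≡⟨ weight-summand-maximal z i i∈Mx ⟨
    f i                                     ≡⟨ lookup∘tabulate f i ⟨
    lookup (tabulate f) i                   ≤⟨ lookup≤sum (tabulate f) i ⟩
    sum (tabulate f)                        ≤⟨ ℕₚ.m≤m+n _ _ ⟩
    sum (tabulate f) ℕ.+ _                  ≡⟨ proj₂ (weight-split z) ⟨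
    weightPwπ 𝔽 P w k z                     ∎
    where
    open ℕₚ.≤-Reasoning
    f = proj₁ (weight-split z)

  Mw≤weight : ∀ z i → lookup (Ix 𝔽 P w k z) i ≡ true → lookup (Mx 𝔽 P w k z) i ≡ false →
              Mw 𝔽 w ℕ.≤ weightPwπ 𝔽 P w k z
  Mw≤weight z i i∈Ix i∉Mx = begin
    Mw 𝔽 w                          ≡⟨ ℕₚ.*-identityˡ _ ⟨
    1 ℕ.* Mw 𝔽 w                    ≤⟨ ℕₚ.*-monoˡ-≤ (Mw 𝔽 w) (lookup-true⇒1≤∣∣ D i i∈D) ⟩
    ∣ D ∣ ℕ.* Mw 𝔽 w                ≤⟨ ℕₚ.m≤n+m _ _ ⟩
    _ ℕ.+ ∣ D ∣ ℕ.* Mw 𝔽 w          ≡⟨ proj₂ (weight-split z) ⟨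
    weightPwπ 𝔽 P w k z             ∎
    where
    open ℕₚ.≤-Reasoning
    D = diff P (Ix 𝔽 P w k z) (Mx 𝔽 P w k z)
    i∈D = lookup-diff P (Ix 𝔽 P w k z) (Mx 𝔽 P w k z) i i∈Ix i∉Mx

  nonzero⇒supp : ∀ (z : W) i s → lookup (lookup z i) s ≢ 0F → lookup (supp 𝔽 P w k z) i ≡ true
  nonzero⇒supp z i s α≢0 = trans (lookup-map i _ z) (cong not (lookup-false⇒and tests s test-false))
    where
    α = lookup (lookup z i) s
    tests = map (λ a → ⌊ a ≟F 0F ⌋) (lookup z i)
    test-false : lookup tests s ≡ false
    test-false = trans (lookup-map s _ (lookup z i)) (trans (isYes≗does (α ≟F 0F)) (dec-false (α ≟F 0F) α≢0))

  module _ (isWeight : IsWeight 𝔽 w) where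

    -- A nonzero coordinate lies in the ideal I_z; it is paid for by the maximal
    -- block containing it or by a copy of M_w.
    w-entry≤weight : ∀ (z : W) i s → w (lookup (lookup z i) s) ℕ.≤ weightPwπ 𝔽 P w k z
    w-entry≤weight z i s with lookup (lookup z i) s ≟F 0F
    ... | yes α≡0 = subst (ℕ._≤ weightPwπ 𝔽 P w k z) (sym (proj₂ (IsWeight.zero-iff isWeight _) α≡0)) ℕ.z≤n
    ... | no α≢0 with lookup (Mx 𝔽 P w k z) i in eq
    ...   | true  = ℕₚ.≤-trans (w-lookup≤wt~ 𝔽 w (lookup z i) s) (wt~≤weight z i eq)
    ...   | false = ℕₚ.≤-trans (w≤Mw 𝔽 w _) (Mw≤weight z i i∈Ix eq)
      where
      i∈Ix : lookup (Ix 𝔽 P w k z) i ≡ true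
      i∈Ix = generated-⊇ P (supp 𝔽 P w k z) i (nonzero⇒supp z i s α≢0)

    distance-positive : ∀ {x y : W} → x ≢ y → 1 ℕ.≤ distPwπ 𝔽 P w k x y
    distance-positive {x} {y} x≢y with ≢⇒∃lookup≢ (≡-dec _≟F_) x≢y
    ... | i , xᵢ≢yᵢ with ≢⇒∃lookup≢ _≟F_ xᵢ≢yᵢ
    ...   | s , xᵢₛ≢yᵢₛ =
      ℕₚ.≤-trans (≢0⇒1≤w 𝔽 isWeight difference≢0) (w-entry≤weight (zipWith (zipWith _-F_) x y) i s)
      where
      difference≢0 : lookup (lookup (zipWith (zipWith _-F_) x y) i) s ≢ 0F
      difference≢0 rewrite lookup-zipWith (zipWith _-F_) i x y | lookup-zipWith _-F_ s (lookup x i) (lookup y i)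
        = xᵢₛ≢yᵢₛ ∘ -F≡0⇒≡ 𝔽 _ _

    minDist-positive : ∀ {C d} → IsMinDist 𝔽 P w k C d → 1 ℕ.≤ d
    minDist-positive ((x , y , _ , _ , x≢y , refl) , _) = distance-positive x≢y

  ceilLog≤N : ∀ {C L} → Unique C → IsCeilLog q (length C) L → L ℕ.≤ n ℕ.* k
  ceilLog≤N unique (_ , least) = least _ (Unique⇒length≤ (↔⇒↣ (Word↔Fin 𝔽 {n} k)) unique)

  sumK-split : ∀ J → Σ (Fin n → ℕ) λ f → sumK 𝔽 P w k J ≡ sum (tabulate f)
  sumK-split J = _ , refl

  sumK-summand : ∀ J i → proj₁ (sumK-split J) i ≡ (if lookup J i then k else 0)
  sumK-summand J i with lookup J i
  ... | true  = refl
  ... | false = refl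

  sumK≡∣∣*k : ∀ J → sumK 𝔽 P w k J ≡ ∣ J ∣ ℕ.* k
  sumK≡∣∣*k J = trans (proj₂ (sumK-split J)) (sum-indicator k J _ (sumK-summand J))

  maxOverIdeals≡ : ∀ {r M} → IsMaxOverIdeals 𝔽 P w k r M → M ≡ r ℕ.* k
  maxOverIdeals≡ ((J , _ , ∣J∣≡r , sumK≡M) , _) =
    trans (sym sumK≡M) (trans (sumK≡∣∣*k J) (cong (ℕ._* k) ∣J∣≡r))

k*-bounds : ∀ M d r k → suc (r ℕ.* M) ℕ.≤ d → d ℕ.≤ suc r ℕ.* M →
            M ℕ.* (r ℕ.* k) ℕ.+ k ℕ.≤ k ℕ.* d × k ℕ.* d ℕ.≤ M ℕ.* (r ℕ.* k ℕ.+ k)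
k*-bounds M d r k lower upper =
    subst (ℕ._≤ k ℕ.* d) (solve 3 (λ M r k → k :* (con 1 :+ r :* M) := M :* (r :* k) :+ k) refl M r k)
          (ℕₚ.*-monoʳ-≤ k lower)
  , subst (k ℕ.* d ℕ.≤_) (solve 3 (λ M r k → k :* (M :+ r :* M) := M :* (r :* k :+ k)) refl M r k)
          (ℕₚ.*-monoʳ-≤ k upper)
  where open +-*-Solver

+n*+k-+L≡+[n*k∸L] : ∀ n k L → L ℕ.≤ n ℕ.* k → (+ n) * (+ k) - + L ≡ + (n ℕ.* k ℕ.∸ L)
+n*+k-+L≡+[n*k∸L] n k L L≤N = begin
  (+ n) * (+ k) - + L   ≡⟨ cong (_- + L) (ℤ.pos-* n k) ⟨
  + (n ℕ.* k) - + L     ≡⟨ ℤ.m-n≡m⊖n (n ℕ.* k) L ⟩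
  n ℕ.* k ⊖ L           ≡⟨ ℤ.⊖-≥ L≤N ⟩
  + (n ℕ.* k ℕ.∸ L)     ∎
  where open ≡-Reasoning

distance-bounds : ∀ {M d r k n L} → suc (r ℕ.* M) ℕ.≤ d → d ℕ.≤ suc r ℕ.* M →
                  L ℕ.≤ n ℕ.* k → n ℕ.* k ℕ.∸ L ≡ r ℕ.* k →
                  ((+ M) * ((+ n) * (+ k) - + L) + + k ≤ (+ k) * (+ d))
                  × ((+ k) * (+ d) ≤ (+ M) * ((+ n) * (+ k) - + L + + k))
distance-bounds {M} {d} {r} {k} {n} {L} lower upper L≤N N-L≡rk
  rewrite +n*+k-+L≡+[n*k∸L] n k L L≤N | N-L≡rk =
    subst₂ _≤_ (trans (ℤ.pos-+ _ k) (cong (_+ + k) (ℤ.pos-* M (r ℕ.* k)))) (ℤ.pos-* k d) (+≤+ (proj₁ bounds))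
  , subst₂ _≤_ (ℤ.pos-* k d) (trans (ℤ.pos-* M _) (cong (+ M *_) (ℤ.pos-+ (r ℕ.* k) k))) (+≤+ (proj₂ bounds))
  where
  bounds = k*-bounds M d r k lower upper

theorem4p2 : ∀ {q : ℕ} (𝔽 : FiniteField q) {n : ℕ} (P : Poset n)
    (w : FiniteField.F 𝔽 → ℕ) → IsWeight 𝔽 w → (k : ℕ)
    (C : List (Word 𝔽 P w k)) → Unique C → 2 Data.Nat.≤ length C
    → (d : ℕ) → IsMinDist 𝔽 P w k C d
    → (L : ℕ) → IsCeilLog q (length C) L
    → IsMDS 𝔽 P w k C
    → ((+ Mw 𝔽 w) * ((+ n) * (+ k) - + L) + + k ≤ (+ k) * (+ d))
    × ((+ k) * (+ d) ≤ (+ Mw 𝔽 w) * ((+ n) * (+ k) - + L + + k))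
theorem4p2 𝔽 {n} P w isWeight k C unique _ d minDist L ceilLog mds =
  distance-bounds {Mw 𝔽 w} {d} {r} {k} {n} (proj₁ d-near-rMw) (proj₂ d-near-rMw)
    (ceilLog≤N 𝔽 P w k unique ceilLog) (maxOverIdeals≡ 𝔽 P w k (mds d L r minDist ceilLog r-isFloor))
  where
  instance
    Mw-nonZero : NonZero (Mw 𝔽 w)
    Mw-nonZero = ℕ.>-nonZero (1≤Mw 𝔽 isWeight)

  r : ℕ
  r = (d ℕ.∸ 1) / Mw 𝔽 w

  r-isFloor : IsFloorDiv (d ℕ.∸ 1) (Mw 𝔽 w) r
  r-isFloor = isFloorDiv-/ (d ℕ.∸ 1) (Mw 𝔽 w)

  d-near-rMw : suc (r ℕ.* Mw 𝔽 w) ℕ.≤ d × d ℕ.≤ suc r ℕ.* Mw 𝔽 w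
  d-near-rMw = isFloorDiv-pred⇒bounds {d} {Mw 𝔽 w} {r} (minDist-positive 𝔽 P w k isWeight minDist) r-isFloor
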